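{- Let $\mathcal G$ be a class of digraphs for which there is a constant $d$ with $\min(\Delta^-(G),\Delta^+(G))\le d$ for all $G\in\mathcal G$. Then $\mathrm{d\text{ - }cutw}$ and $\mathrm{d\text{ - }pw}$ are linearly equivalent on $\mathcal G$: there exist linear functions $f_1,f_2$ such that for every $G\in\mathcal G$, $\mathrm{d\text{ - }cutw}(G)\le f_1(\mathrm{d\text{ - }pw}(G))$ and $\mathrm{d\text{ - }pw}(G)\le f_2(\mathrm{d\text{ - }cutw}(G))$.
   Context: Digraphs $G=(V,E)$ are finite with $E\subseteq\{(u,v):u\ne v\}$; $\Delta^+(G)$ and $\Delta^-(G)$ denote the maximum out-degree and maximum in-degree. A layout is a bijection $\varphi:V\to\{1,\dots,|V|\}$; $L(i,\varphi)=\{u:\varphi(u)\le i\}$, $R(i,\varphi)=\{u:\varphi(u)>i\}$. $\mathrm{d\text{ - }pw}(G)$ is the minimum of $\max|X_i|-1$ over sequences $(X_1,\dots,X_r)$ of subsets of $V$ with $\bigcup X_i=V$, for each $(u,v)\in E$ some $i\le j$ with $u\in X_i,v\in X_j$, and $X_i\cap X_\ell\subseteq X_j$ for $i<j<\ell$. $\mathrm{d\text{ - }cutw}(G)=\min_\varphi\max_i|\{(u,v)\in E:u\in L(i,\varphi),v\in R(i,\varphi)\}|$. -}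

module Defs where

open import Data.Nat using (ℕ; zero; suc; _+_; _*_; _≤_; _<ᵇ_; _≤ᵇ_; _⊔_; _⊓_)
open import Data.Bool using (Bool; true; false; if_then_else_; _∧_)
open import Data.Fin using (Fin; toℕ) renaming (zero to fzero; suc to fsuc)
import Data.Fin as F
open import Data.Fin.Subset using (Subset; _∈_; ∣_∣)
open import Data.Fin.Permutation using (Permutation′; _⟨$⟩ʳ_)
open import Data.Product using (Σ; ∃; _×_)
open import Relation.Binary.PropositionalEquality using (_≡_)

record Digraph : Set where
  field
    n     : ℕ
    adj   : Fin n → Fin n → Bool
    loopless : ∀ u → adj u u ≡ false
open Digraph public

sumF : ∀ {m} → (Fin m → ℕ) → ℕ
sumF {zero}  f = 0
sumF {suc m} f = f fzero + sumF (λ i → f (fsuc i))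

maxF : ∀ {m} → (Fin m → ℕ) → ℕ
maxF {zero}  f = 0
maxF {suc m} f = f fzero ⊔ maxF (λ i → f (fsuc i))

ind : Bool → ℕ
ind b = if b then 1 else 0

outdeg : (G : Digraph) → Fin (n G) → ℕ
outdeg G u = sumF (λ v → ind (adj G u v))

indeg : (G : Digraph) → Fin (n G) → ℕ
indeg G v = sumF (λ u → ind (adj G u v))

Δ⁺ : Digraph → ℕ
Δ⁺ G = maxF (outdeg G)

Δ⁻ : Digraph → ℕ
Δ⁻ G = maxF (indeg G)

record DPathDecomposition (G : Digraph) : Set where
  field
    r     : ℕ
    bag   : Fin r → Subset (n G)
    cover : ∀ v → ∃ λ i → v ∈ bag i
    edge  : ∀ u v → adj G u v ≡ true →
            Σ (Fin r) λ i → Σ (Fin r) λ j → i F.≤ j × u ∈ bag i × v ∈ bag j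
    interp : ∀ i j l → i F.< j → j F.< l → ∀ v → v ∈ bag i → v ∈ bag l → v ∈ bag j
open DPathDecomposition public

-- width ≤ k, i.e. max |X_i| - 1 ≤ k
DPWAtMost : Digraph → ℕ → Set
DPWAtMost G k = Σ (DPathDecomposition G) λ D → ∀ i → ∣ bag D i ∣ ≤ suc k

IsDPW : Digraph → ℕ → Set
IsDPW G p = DPWAtMost G p × (∀ k → DPWAtMost G k → p ≤ k)

-- Directed cutwidth. A layout is a bijection φ : V → Fin n (0-indexed,
-- so φ u ≤ i in the paper's 1-indexed convention becomes toℕ (φ u) < i).

cutSize : (G : Digraph) → Permutation′ (n G) → ℕ → ℕ
cutSize G φ i = sumF λ u → sumF λ v →
  ind (adj G u v ∧ (toℕ (φ ⟨$⟩ʳ u) <ᵇ i) ∧ (i ≤ᵇ toℕ (φ ⟨$⟩ʳ v)))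

DCutwAtMost : Digraph → ℕ → Set
DCutwAtMost G k = Σ (Permutation′ (n G)) λ φ → ∀ i → cutSize G φ i ≤ k

IsDCutw : Digraph → ℕ → Set
IsDCutw G c = DCutwAtMost G c × (∀ k → DCutwAtMost G k → c ≤ k)

lin : ℕ → ℕ → ℕ → ℕ
lin a b x = a * x + b

module Submission where

-- Given a layout φ of cutwidth c, let the interval of
-- a vertex u run from its own position to the furthest position of u or an
-- out-neighbour of u.  Taking one bag per position (in reverse order) holding
-- the vertices whose interval contains it gives a directed path decomposition;
-- a bag contains the vertex at its position plus one tail of a distinct
-- crossing edge for every other member, so it has at most c + 1 vertices.
--
-- Given a decomposition of width p, lay the vertices
-- out in decreasing order of the last bag containing them (if Δ⁺ ≤ d) or of
-- the first bag containing them (if Δ⁻ ≤ d).  Then all edges crossing a cut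
-- have their tail (resp. head) in one common bag, so the cut has at most
-- d · (p + 1) edges.

open import Defs
open import Data.Nat using (ℕ; zero; suc; _+_; _*_; _∸_; _≤_; _<_; _<ᵇ_; _≤ᵇ_; _⊔_; _⊓_; z≤n; s≤s; _≟_)
open import Data.Nat.Properties
open import Data.Bool using (true; false; _∧_; T; if_then_else_)
open import Data.Unit using (tt)
open import Data.Fin using (Fin; toℕ; fromℕ<; opposite; punchOut) renaming (zero to fzero; suc to fsuc)
import Data.Fin as F
import Data.Fin.Properties as FinP
open import Data.Fin.Subset using (Subset; _∈_; ∣_∣) renaming (⊥ to ∅)
open import Data.Fin.Subset.Properties using (_∈?_; ∣⊥∣≡0)
open import Data.Fin.Permutation using (Permutation′; permutation; _⟨$⟩ʳ_; _⟨$⟩ˡ_; inverseˡ; inverseʳ)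
open import Data.Vec using ([]; _∷_; tabulate)
open import Data.Vec.Properties using (lookup∘tabulate; lookup⇒[]=; []=⇒lookup)
open import Data.Product using (Σ; ∃; _×_; _,_; proj₁; proj₂)
open import Data.Sum using (_⊎_; inj₁; inj₂)
open import Data.Empty using (⊥-elim)
open import Function.Definitions using (Injective)
open import Function.Bundles using (mk⇔)
open import Relation.Nullary using (¬_; Dec; yes; no; does; contradiction; _×-dec_)
open import Relation.Nullary.Decidable using (dec-true; dec-false; does-⇔)
open import Relation.Unary using (Decidable)
open import Relation.Binary using (tri<; tri≈; tri>)
open import Relation.Binary.PropositionalEquality
open import Algebra.Properties.CommutativeMonoid.Sum +-0-commutativeMonoid using (sum; ∑-distrib-+; ∑-comm)
open import Algebra.Properties.Semiring.Sum +-*-semiring using (*-distribˡ-sum)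

sumF≡sum : ∀ {m} (f : Fin m → ℕ) → sumF f ≡ sum f
sumF≡sum {zero}  f = refl
sumF≡sum {suc m} f = cong (f fzero +_) (sumF≡sum (λ i → f (fsuc i)))

sumF-cong : ∀ {m} {f g : Fin m → ℕ} → (∀ i → f i ≡ g i) → sumF f ≡ sumF g
sumF-cong {zero}  f≗g = refl
sumF-cong {suc m} f≗g = cong₂ _+_ (f≗g fzero) (sumF-cong (λ i → f≗g (fsuc i)))

sumF-+ : ∀ {m} (f g : Fin m → ℕ) → sumF (λ i → f i + g i) ≡ sumF f + sumF g
sumF-+ f g = begin
  sumF (λ i → f i + g i) ≡⟨ sumF≡sum (λ i → f i + g i) ⟩
  sum (λ i → f i + g i)  ≡⟨ ∑-distrib-+ f g ⟩
  sum f + sum g          ≡⟨ sym (cong₂ _+_ (sumF≡sum f) (sumF≡sum g)) ⟩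
  sumF f + sumF g        ∎
  where open ≡-Reasoning

sumF-*ˡ : ∀ {m} (c : ℕ) (f : Fin m → ℕ) → sumF (λ i → c * f i) ≡ c * sumF f
sumF-*ˡ c f = begin
  sumF (λ i → c * f i) ≡⟨ sumF≡sum (λ i → c * f i) ⟩
  sum (λ i → c * f i)  ≡⟨ sym (*-distribˡ-sum c f) ⟩
  c * sum f            ≡⟨ cong (c *_) (sym (sumF≡sum f)) ⟩
  c * sumF f           ∎
  where open ≡-Reasoning

sumF-comm : ∀ {m k} (h : Fin m → Fin k → ℕ) →
  sumF (λ u → sumF (λ v → h u v)) ≡ sumF (λ v → sumF (λ u → h u v))
sumF-comm h = begin
  sumF (λ u → sumF (h u))               ≡⟨ sumF-cong (λ u → sumF≡sum (h u)) ⟩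
  sumF (λ u → sum (h u))                ≡⟨ sumF≡sum (λ u → sum (h u)) ⟩
  sum (λ u → sum (h u))                 ≡⟨ ∑-comm h ⟩
  sum (λ v → sum (λ u → h u v))         ≡⟨ sym (sumF≡sum (λ v → sum (λ u → h u v))) ⟩
  sumF (λ v → sum (λ u → h u v))        ≡⟨ sumF-cong (λ v → sym (sumF≡sum (λ u → h u v))) ⟩
  sumF (λ v → sumF (λ u → h u v))       ∎
  where open ≡-Reasoning

sumF-zero : ∀ {m} {f : Fin m → ℕ} → (∀ i → f i ≡ 0) → sumF f ≡ 0
sumF-zero {zero}  f≗0 = refl
sumF-zero {suc m} f≗0 = cong₂ _+_ (f≗0 fzero) (sumF-zero (λ i → f≗0 (fsuc i)))

sumF-ones : ∀ m → sumF {m} (λ _ → 1) ≡ m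
sumF-ones zero    = refl
sumF-ones (suc m) = cong suc (sumF-ones m)

sumF-mono : ∀ {m} {f g : Fin m → ℕ} → (∀ i → f i ≤ g i) → sumF f ≤ sumF g
sumF-mono {zero}  f≤g = z≤n
sumF-mono {suc m} f≤g = +-mono-≤ (f≤g fzero) (sumF-mono (λ i → f≤g (fsuc i)))

sumF-mono-< : ∀ {m} {f g : Fin m → ℕ} → (∀ i → f i ≤ g i) → ∀ j → f j < g j → sumF f < sumF g
sumF-mono-< f≤g fzero    fj<gj = +-mono-<-≤ fj<gj (sumF-mono (λ i → f≤g (fsuc i)))
sumF-mono-< f≤g (fsuc j) fj<gj = +-mono-≤-< (f≤g fzero) (sumF-mono-< (λ i → f≤g (fsuc i)) j fj<gj)

term≤sumF : ∀ {m} (f : Fin m → ℕ) j → f j ≤ sumF f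
term≤sumF f fzero    = m≤m+n _ _
term≤sumF f (fsuc j) = ≤-trans (term≤sumF (λ i → f (fsuc i)) j) (m≤n+m _ _)

term≤maxF : ∀ {m} (f : Fin m → ℕ) j → f j ≤ maxF f
term≤maxF f fzero    = m≤m⊔n _ _
term≤maxF f (fsuc j) = ≤-trans (term≤maxF (λ i → f (fsuc i)) j) (m≤n⊔m _ _)

maxF-attained : ∀ {m} (f : Fin m → ℕ) {i} → 0 < i → i ≤ maxF f → ∃ λ j → i ≤ f j
maxF-attained {zero}  f 0<i i≤0 = ⊥-elim (<⇒≱ 0<i i≤0)
maxF-attained {suc m} f 0<i i≤max with ⊔-sel (f fzero) (maxF (λ j → f (fsuc j)))
... | inj₁ max≡f0 = fzero , subst (_ ≤_) max≡f0 i≤max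
... | inj₂ max≡rest with maxF-attained (λ j → f (fsuc j)) 0<i (subst (_ ≤_) max≡rest i≤max)
...   | j , i≤fj = fsuc j , i≤fj

count : ∀ {m} {P : Fin m → Set} → Decidable P → ℕ
count P? = sumF (λ x → ind (does (P? x)))

ind≤1 : ∀ b → ind b ≤ 1
ind≤1 true  = s≤s z≤n
ind≤1 false = z≤n

ind-yes : ∀ {P : Set} (P? : Dec P) → P → ind (does P?) ≡ 1
ind-yes P? p = cong ind (dec-true P? p)

ind-no : ∀ {P : Set} (P? : Dec P) → ¬ P → ind (does P?) ≡ 0
ind-no P? ¬p = cong ind (dec-false P? ¬p)

count≤1 : ∀ {m} {P : Fin m → Set} (P? : Decidable P) →
  (∀ {x y} → P x → P y → x ≡ y) → count P? ≤ 1
count≤1 {zero}  P? unique = z≤n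
count≤1 {suc m} P? unique with P? fzero
... | yes p0 = s≤s (≤-reflexive (sumF-zero λ i →
                 ind-no (P? (fsuc i)) (λ pi → FinP.0≢1+n (unique p0 pi))))
... | no _   = count≤1 (λ i → P? (fsuc i)) (λ px py → FinP.suc-injective (unique px py))

∣S∣≡count : ∀ {m} (S : Subset m) → ∣ S ∣ ≡ count (_∈? S)
∣S∣≡count []          = refl
∣S∣≡count (true ∷ S)  = cong suc (∣S∣≡count S)
∣S∣≡count (false ∷ S) = ∣S∣≡count S

weight≤ : ∀ {m} (S : Subset m) (g : Fin m → ℕ) {d} → (∀ x → g x ≤ d) →
  sumF (λ x → ind (does (x ∈? S)) * g x) ≤ d * ∣ S ∣
weight≤ S g {d} g≤d = begin
  sumF (λ x → ind (does (x ∈? S)) * g x) ≤⟨ sumF-mono (λ x → ≤-trans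
                                              (*-monoʳ-≤ (ind (does (x ∈? S))) (g≤d x))
                                              (≤-reflexive (*-comm _ d))) ⟩
  sumF (λ x → d * ind (does (x ∈? S)))   ≡⟨ sumF-*ˡ d (λ x → ind (does (x ∈? S))) ⟩
  d * count (_∈? S)                      ≡⟨ cong (d *_) (sym (∣S∣≡count S)) ⟩
  d * ∣ S ∣                              ∎
  where open ≤-Reasoning

select : ∀ {m} {P : Fin m → Set} → Decidable P → Subset m
select P? = tabulate (λ x → does (P? x))

select⁺ : ∀ {m} {P : Fin m → Set} (P? : Decidable P) {x} → P x → x ∈ select P?
select⁺ P? {x} px = lookup⇒[]= x _ (trans (lookup∘tabulate _ x) (dec-true (P? x) px))

select⁻ : ∀ {m} {P : Fin m → Set} (P? : Decidable P) {x} → x ∈ select P? → P x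
select⁻ {P = P} P? {x} x∈S =
  witness (P? x) (trans (sym (lookup∘tabulate (λ y → does (P? y)) x)) ([]=⇒lookup x∈S))
  where
  witness : (d : Dec (P x)) → does d ≡ true → P x
  witness (yes px) _ = px

∣select∣ : ∀ {m} {P : Fin m → Set} (P? : Decidable P) → ∣ select P? ∣ ≡ count P?
∣select∣ P? = trans (∣S∣≡count (select P?)) (sumF-cong λ x →
  cong ind (does-⇔ (mk⇔ (select⁻ P?) (select⁺ P?)) (x ∈? select P?) (P? x)))

firstIndex : ∀ {m} {P : Fin m → Set} → Decidable P → ∃ P →
  Σ (Fin m) λ j → P j × (∀ k → P k → j F.≤ k)
firstIndex {suc m} P? (j₀ , pj₀) with P? fzero
... | yes p0 = fzero , p0 , λ _ _ → z≤n
firstIndex {suc m} P? (fzero , pj₀)   | no ¬p0 = contradiction pj₀ ¬p0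
firstIndex {suc m} P? (fsuc j₀ , pj₀) | no ¬p0 with firstIndex (λ k → P? (fsuc k)) (j₀ , pj₀)
... | j , pj , least = fsuc j , pj , λ { fzero pk → contradiction pk ¬p0 ; (fsuc k) pk → s≤s (least k pk) }

lastIndex : ∀ {m} {P : Fin m → Set} → Decidable P → ∃ P →
  Σ (Fin m) λ j → P j × (∀ k → P k → k F.≤ j)
lastIndex {suc m} P? (j₀ , pj₀) with FinP.any? (λ k → P? (fsuc k))
... | yes later with lastIndex (λ k → P? (fsuc k)) later
...   | j , pj , greatest = fsuc j , pj , λ { fzero _ → z≤n ; (fsuc k) pk → s≤s (greatest k pk) }
lastIndex {suc m} P? (fzero , pj₀)   | no ¬later = fzero , pj₀ , λ { fzero _ → z≤n ; (fsuc k) pk → contradiction (k , pk) ¬later }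
lastIndex {suc m} P? (fsuc j₀ , pj₀) | no ¬later = contradiction (j₀ , pj₀) ¬later

-- Layouts.  An injective self-map of Fin N is a permutation (pigeonhole),
-- so ranking the vertices along a strict total order yields a layout that
-- extends the order.

injective⇒surjective : ∀ {N} {f : Fin N → Fin N} → Injective _≡_ _≡_ f → ∀ y → ∃ λ x → f x ≡ y
injective⇒surjective {N} {f} f-inj y with FinP.any? (λ x → f x FinP.≟ y)
... | yes hit = hit
injective⇒surjective {suc m} {f} f-inj y | no miss =
  contradiction (FinP.injective⇒≤ avoid-inj) (<⇒≱ (n<1+n m))
  where
  y≢f : ∀ x → y ≢ f x
  y≢f x y≡fx = miss (x , sym y≡fx)
  -- f misses y, so it squeezes Fin (suc m) injectively into Fin m.
  avoid : Fin (suc m) → Fin m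
  avoid x = punchOut (y≢f x)
  avoid-inj : Injective _≡_ _≡_ avoid
  avoid-inj {a} {b} eq = f-inj (FinP.punchOut-injective (y≢f a) (y≢f b) eq)

injective⇒permutation : ∀ {N} (f : Fin N → Fin N) → Injective _≡_ _≡_ f →
  Σ (Permutation′ N) λ π → ∀ x → π ⟨$⟩ʳ x ≡ f x
injective⇒permutation {N} f f-inj =
  permutation f preimage (λ y → proj₂ (injective⇒surjective f-inj y))
                         (λ x → f-inj (proj₂ (injective⇒surjective f-inj (f x)))) ,
  λ _ → refl
  where
  preimage : Fin N → Fin N
  preimage y = proj₁ (injective⇒surjective f-inj y)

module Ranking {N : ℕ} {_≺_ : Fin N → Fin N → Set}
  (_≺?_ : ∀ x y → Dec (x ≺ y))
  (≺-irrefl : ∀ {x} → ¬ x ≺ x)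
  (≺-trans : ∀ {x y z} → x ≺ y → y ≺ z → x ≺ z)
  (≺-connex : ∀ {x y} → x ≢ y → x ≺ y ⊎ y ≺ x)
  where

  rank : Fin N → ℕ
  rank x = count (_≺? x)

  rank-mono : ∀ {x y} → x ≺ y → rank x < rank y
  rank-mono {x} {y} x≺y = sumF-mono-< below-x⊆below-y x
    (subst₂ _<_ (sym (ind-no (x ≺? x) ≺-irrefl)) (sym (ind-yes (x ≺? y) x≺y)) (s≤s z≤n))
    where
    below-x⊆below-y : ∀ z → ind (does (z ≺? x)) ≤ ind (does (z ≺? y))
    below-x⊆below-y z with z ≺? x
    ... | yes z≺x = ≤-reflexive (sym (ind-yes (z ≺? y) (≺-trans z≺x x≺y)))
    ... | no _    = z≤n

  rank<N : ∀ x → rank x < N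
  rank<N x = subst (rank x <_) (sumF-ones N)
    (sumF-mono-< (λ z → ind≤1 (does (z ≺? x))) x (subst (_< 1) (sym (ind-no (x ≺? x) ≺-irrefl)) (s≤s z≤n)))

  rank-injective : ∀ {x y} → rank x ≡ rank y → x ≡ y
  rank-injective {x} {y} eq with x FinP.≟ y
  ... | yes x≡y = x≡y
  ... | no x≢y with ≺-connex x≢y
  ...   | inj₁ x≺y = contradiction eq (<⇒≢ (rank-mono x≺y))
  ...   | inj₂ y≺x = contradiction (sym eq) (<⇒≢ (rank-mono y≺x))

  layout : Σ (Permutation′ N) λ π → ∀ {x y} → x ≺ y → toℕ (π ⟨$⟩ʳ x) < toℕ (π ⟨$⟩ʳ y)
  layout with injective⇒permutation (λ x → fromℕ< (rank<N x))
                (λ eq → rank-injective (FinP.fromℕ<-injective _ _ (rank<N _) (rank<N _) eq))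
  ... | π , π≗rank = π , λ {x} {y} x≺y → subst₂ _<_ (sym (position x)) (sym (position y)) (rank-mono x≺y)
    where
    position : ∀ x → toℕ (π ⟨$⟩ʳ x) ≡ rank x
    position x = trans (cong toℕ (π≗rank x)) (FinP.toℕ-fromℕ< (rank<N x))

module KeyDescending {N : ℕ} (κ : Fin N → ℕ) where

  _≺_ : Fin N → Fin N → Set
  x ≺ y = κ y < κ x ⊎ (κ x ≡ κ y × toℕ x < toℕ y)

  _≺?_ : ∀ x y → Dec (x ≺ y)
  x ≺? y with κ y <? κ x | κ x ≟ κ y | toℕ x <? toℕ y
  ... | yes κy<κx | _        | _       = yes (inj₁ κy<κx)
  ... | no κy≮κx  | yes κx≡κy | yes x<y = yes (inj₂ (κx≡κy , x<y))
  ... | no κy≮κx  | no κx≢κy  | _       = no λ { (inj₁ lt) → κy≮κx lt ; (inj₂ (eq , _)) → κx≢κy eq }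
  ... | no κy≮κx  | yes _     | no x≮y  = no λ { (inj₁ lt) → κy≮κx lt ; (inj₂ (_ , lt)) → x≮y lt }

  ≺-irrefl : ∀ {x} → ¬ x ≺ x
  ≺-irrefl (inj₁ lt)       = <-irrefl refl lt
  ≺-irrefl (inj₂ (_ , lt)) = <-irrefl refl lt

  ≺-trans : ∀ {x y z} → x ≺ y → y ≺ z → x ≺ z
  ≺-trans         (inj₁ p)        (inj₁ q)         = inj₁ (<-trans q p)
  ≺-trans {x}     (inj₁ p)        (inj₂ (eq , _))  = inj₁ (subst (_< κ x) eq p)
  ≺-trans {z = z} (inj₂ (eq , _)) (inj₁ q)         = inj₁ (subst (κ z <_) (sym eq) q)
  ≺-trans         (inj₂ (e , p))  (inj₂ (e′ , q))  = inj₂ (trans e e′ , <-trans p q)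

  ≺-connex : ∀ {x y} → x ≢ y → x ≺ y ⊎ y ≺ x
  ≺-connex {x} {y} x≢y with <-cmp (κ x) (κ y) | <-cmp (toℕ x) (toℕ y)
  ... | tri< κx<κy _ _ | _             = inj₂ (inj₁ κx<κy)
  ... | tri> _ _ κy<κx | _             = inj₁ (inj₁ κy<κx)
  ... | tri≈ _ κx≡κy _ | tri< x<y _ _  = inj₁ (inj₂ (κx≡κy , x<y))
  ... | tri≈ _ κx≡κy _ | tri> _ _ y<x  = inj₂ (inj₂ (sym κx≡κy , y<x))
  ... | tri≈ _ _ _     | tri≈ _ x≡y _  = contradiction (FinP.toℕ-injective x≡y) x≢y

descendingLayout : ∀ {N} (κ : Fin N → ℕ) →
  Σ (Permutation′ N) λ π → ∀ x y → toℕ (π ⟨$⟩ʳ x) ≤ toℕ (π ⟨$⟩ʳ y) → κ y ≤ κ x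
descendingLayout {N} κ = π , nonIncreasing
  where
  open KeyDescending κ
  open Ranking _≺?_ ≺-irrefl ≺-trans ≺-connex using (layout)
  π : Permutation′ N
  π = proj₁ layout
  nonIncreasing : ∀ x y → toℕ (π ⟨$⟩ʳ x) ≤ toℕ (π ⟨$⟩ʳ y) → κ y ≤ κ x
  nonIncreasing x y x≤y with κ x <? κ y
  ... | no κx≮κy = ≮⇒≥ κx≮κy
  ... | yes κx<κy = contradiction x≤y (<⇒≱ (proj₂ layout (inj₁ κx<κy)))

opposite-antitone : ∀ {N} {a b : Fin N} → a F.≤ b → opposite b F.≤ opposite a
opposite-antitone {N} {a} {b} a≤b
  rewrite FinP.opposite-prop a | FinP.opposite-prop b = ∸-monoʳ-≤ N (s≤s a≤b)

opposite-antitone-< : ∀ {N} {a b : Fin N} → a F.< b → opposite b F.< opposite a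
opposite-antitone-< {N} {a} {b} a<b
  rewrite FinP.opposite-prop a | FinP.opposite-prop b = ∸-monoʳ-< (s≤s a<b) (FinP.toℕ<n b)

-- Indicators of a conjunction of three Booleans, the shape of the summands
-- of `cutSize`.
ind-∧³≡1 : ∀ {a b c} → a ≡ true → T b → T c → ind (a ∧ b ∧ c) ≡ 1
ind-∧³≡1 {true} {true} {true} _ _ _ = refl

ind-∧³≤ : ∀ a b c x → (a ≡ true → T b → T c → x ≡ true) → ind (a ∧ b ∧ c) ≤ ind x * ind a
ind-∧³≤ true  true  true  x forces rewrite forces refl tt tt = s≤s z≤n
ind-∧³≤ true  true  false x _ = z≤n
ind-∧³≤ true  false c     x _ = z≤n
ind-∧³≤ false b     c     x _ = z≤n

module Cuts (G : Digraph) (φ : Permutation′ (n G)) where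

  pos : Fin (n G) → ℕ
  pos u = toℕ (φ ⟨$⟩ʳ u)

  pos-injective : ∀ {x y} → pos x ≡ pos y → x ≡ y
  pos-injective {x} {y} eq = begin
    x                 ≡⟨ sym (inverseˡ φ) ⟩
    φ ⟨$⟩ˡ (φ ⟨$⟩ʳ x) ≡⟨ cong (φ ⟨$⟩ˡ_) (FinP.toℕ-injective eq) ⟩
    φ ⟨$⟩ˡ (φ ⟨$⟩ʳ y) ≡⟨ inverseˡ φ ⟩
    y                 ∎
    where open ≡-Reasoning

  Crosses : ℕ → Fin (n G) → Fin (n G) → Set
  Crosses i u v = adj G u v ≡ true × pos u < i × i ≤ pos v

  crossTerm : ℕ → Fin (n G) → Fin (n G) → ℕ
  crossTerm i u v = ind (adj G u v ∧ (pos u <ᵇ i) ∧ (i ≤ᵇ pos v))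

  crossTerm-crossing : ∀ {i u v} → Crosses i u v → crossTerm i u v ≡ 1
  crossTerm-crossing (u→v , pu<i , i≤pv) = ind-∧³≡1 u→v (<⇒<ᵇ pu<i) (≤⇒≤ᵇ i≤pv)

  crossTerm≤ : ∀ {i u v} x → (Crosses i u v → x ≡ true) → crossTerm i u v ≤ ind x * ind (adj G u v)
  crossTerm≤ {i} {u} {v} x forces = ind-∧³≤ (adj G u v) (pos u <ᵇ i) (i ≤ᵇ pos v) x
    (λ u→v pu<i i≤pv → forces (u→v , <ᵇ⇒< _ _ pu<i , ≤ᵇ⇒≤ _ _ i≤pv))

  occupant : ∀ {i u v} → Crosses i u v → ∃ λ w → pos w ≡ i ∸ 1
  occupant {suc k} (_ , _ , k<pv) =
    φ ⟨$⟩ˡ fromℕ< k<N , trans (cong toℕ (inverseʳ φ)) (FinP.toℕ-fromℕ< k<N)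
    where
    k<N : k < n G
    k<N = <-trans k<pv (FinP.toℕ<n _)

  straddles : ∀ {i u v w} → Crosses i u v → pos w ≡ i ∸ 1 → pos u ≤ pos w × pos w < pos v
  straddles {suc k} {u} {v} (_ , s≤s pu≤k , k<pv) pw≡k =
    subst (pos u ≤_) (sym pw≡k) pu≤k , subst (_< pos v) (sym pw≡k) k<pv

  cut≤tails : ∀ i (S : Subset (n G)) → (∀ {u v} → Crosses i u v → u ∈ S) →
    cutSize G φ i ≤ sumF (λ u → ind (does (u ∈? S)) * outdeg G u)
  cut≤tails i S tails = begin
    cutSize G φ i
      ≤⟨ sumF-mono (λ u → sumF-mono (λ v →
           crossTerm≤ {i} {u} {v} (does (u ∈? S)) (λ cross → dec-true (u ∈? S) (tails cross)))) ⟩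
    sumF (λ u → sumF (λ v → ind (does (u ∈? S)) * ind (adj G u v)))
      ≡⟨ sumF-cong (λ u → sumF-*ˡ (ind (does (u ∈? S))) (λ v → ind (adj G u v))) ⟩
    sumF (λ u → ind (does (u ∈? S)) * outdeg G u) ∎
    where open ≤-Reasoning

  cut≤heads : ∀ i (S : Subset (n G)) → (∀ {u v} → Crosses i u v → v ∈ S) →
    cutSize G φ i ≤ sumF (λ v → ind (does (v ∈? S)) * indeg G v)
  cut≤heads i S heads = begin
    cutSize G φ i
      ≤⟨ sumF-mono (λ u → sumF-mono (λ v →
           crossTerm≤ {i} {u} {v} (does (v ∈? S)) (λ cross → dec-true (v ∈? S) (heads cross)))) ⟩
    sumF (λ u → sumF (λ v → ind (does (v ∈? S)) * ind (adj G u v)))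
      ≡⟨ sumF-comm (λ u v → ind (does (v ∈? S)) * ind (adj G u v)) ⟩
    sumF (λ v → sumF (λ u → ind (does (v ∈? S)) * ind (adj G u v)))
      ≡⟨ sumF-cong (λ v → sumF-*ˡ (ind (does (v ∈? S))) (λ u → ind (adj G u v))) ⟩
    sumF (λ v → ind (does (v ∈? S)) * indeg G v) ∎
    where open ≤-Reasoning

module CutToPath (G : Digraph) (φ : Permutation′ (n G)) {c : ℕ}
  (narrow : ∀ i → cutSize G φ i ≤ c) where

  open Cuts G φ

  reach : Fin (n G) → ℕ
  reach u = pos u ⊔ maxF (λ v → if adj G u v then pos v else 0)

  reach-edge : ∀ {u v} → adj G u v ≡ true → pos v ≤ reach u
  reach-edge {u} {v} u→v = ≤-trans
    (subst (λ b → pos v ≤ (if b then pos v else 0)) (sym u→v) ≤-refl)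
    (≤-trans (term≤maxF (λ w → if adj G u w then pos w else 0) v) (m≤n⊔m _ _))

  Active : ℕ → Fin (n G) → Set
  Active k u = pos u ≤ k × k ≤ reach u

  active? : ∀ k → Decidable (Active k)
  active? k u = pos u ≤? k ×-dec k ≤? reach u

  active-own : ∀ u → Active (pos u) u
  active-own u = ≤-refl , m≤m⊔n _ _

  active⇒crossing : ∀ {k u} → Active k u → pos u ≢ k → ∃ λ v → Crosses k u v
  active⇒crossing {k} {u} (pu≤k , k≤reach) pu≢k =
    neighbour (maxF-attained (λ v → if adj G u v then pos v else 0) 0<k k≤max)
    where
    pu<k : pos u < k
    pu<k = ≤∧≢⇒< pu≤k pu≢k
    0<k : 0 < k
    0<k = ≤-trans (s≤s z≤n) pu<k
    k≤max : k ≤ maxF (λ v → if adj G u v then pos v else 0)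
    k≤max with ⊔-sel (pos u) (maxF (λ v → if adj G u v then pos v else 0))
    ... | inj₁ reach≡pu = contradiction (subst (k ≤_) reach≡pu k≤reach) (<⇒≱ pu<k)
    ... | inj₂ reach≡max = subst (k ≤_) reach≡max k≤reach
    neighbour : (∃ λ v → k ≤ (if adj G u v then pos v else 0)) → ∃ λ v → Crosses k u v
    neighbour (v , k≤) with adj G u v in u→v
    ... | true  = v , u→v , pu<k , k≤
    ... | false = contradiction k≤ (<⇒≱ 0<k)

  -- Bag j collects the vertices active at position `at j`; the bags list
  -- the positions from last to first, and `slot u` indexes u's own position.
  at : Fin (n G) → ℕ
  at j = toℕ (opposite j)

  bagAt : Fin (n G) → Subset (n G)
  bagAt j = select (active? (at j))

  slot : Fin (n G) → Fin (n G)
  slot u = opposite (φ ⟨$⟩ʳ u)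

  at-slot : ∀ u → at (slot u) ≡ pos u
  at-slot u = cong toℕ (FinP.opposite-involutive (φ ⟨$⟩ʳ u))

  ∈slot : ∀ {u w} → Active (pos w) u → u ∈ bagAt (slot w)
  ∈slot {u} {w} act = select⁺ (active? (at (slot w))) (subst (λ k → Active k u) (sym (at-slot w)) act)

  slot-antitone : ∀ {u v} → pos v ≤ pos u → slot u F.≤ slot v
  slot-antitone pv≤pu = opposite-antitone pv≤pu

  edge-bags : ∀ u v → adj G u v ≡ true →
    Σ (Fin (n G)) λ i → Σ (Fin (n G)) λ j → i F.≤ j × u ∈ bagAt i × v ∈ bagAt j
  edge-bags u v u→v with pos v ≤? pos u
  ... | yes pv≤pu = slot u , slot v , slot-antitone pv≤pu , ∈slot (active-own u) , ∈slot (active-own v)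
  ... | no pv≰pu  = slot v , slot v , ≤-refl ,
                    ∈slot (<⇒≤ (≰⇒> pv≰pu) , reach-edge u→v) , ∈slot (active-own v)

  -- Bags between two bags containing v contain v: activity is an interval.
  interpolation : ∀ i j l → i F.< j → j F.< l → ∀ v → v ∈ bagAt i → v ∈ bagAt l → v ∈ bagAt j
  interpolation i j l i<j j<l v v∈i v∈l with select⁻ (active? (at i)) v∈i | select⁻ (active? (at l)) v∈l
  ... | _ , at-i≤reach | pv≤at-l , _ = select⁺ (active? (at j))
    ( ≤-trans pv≤at-l (<⇒≤ (opposite-antitone-< j<l))
    , ≤-trans (<⇒≤ (opposite-antitone-< i<j)) at-i≤reach)

  decomposition : DPathDecomposition G
  decomposition = record
    { r      = n G
    ; bag    = bagAt
    ; cover  = λ v → slot v , ∈slot (active-own v)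
    ; edge   = edge-bags
    ; interp = interpolation
    }

  active-charge : ∀ k u → ind (does (active? k u)) ≤ ind (does (pos u ≟ k)) + sumF (crossTerm k u)
  active-charge k u = charge (active? k u) (pos u ≟ k)
    where
    charge : (act? : Dec (Active k u)) (own? : Dec (pos u ≡ k)) →
      ind (does act?) ≤ ind (does own?) + sumF (crossTerm k u)
    charge (no _)    _          = z≤n
    charge (yes _)   (yes _)    = s≤s z≤n
    charge (yes act) (no pu≢k)  with active⇒crossing act pu≢k
    ... | v , cross = ≤-trans (≤-reflexive (sym (crossTerm-crossing cross))) (term≤sumF (crossTerm k u) v)

  bag-size : ∀ j → ∣ bagAt j ∣ ≤ suc c
  bag-size j = begin
    ∣ bagAt j ∣                                                  ≡⟨ ∣select∣ (active? k) ⟩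
    count (active? k)                                            ≤⟨ sumF-mono (active-charge k) ⟩
    sumF (λ u → ind (does (pos u ≟ k)) + sumF (crossTerm k u))   ≡⟨ sumF-+ (λ u → ind (does (pos u ≟ k))) (λ u → sumF (crossTerm k u)) ⟩
    count (λ u → pos u ≟ k) + cutSize G φ k                      ≤⟨ +-mono-≤ (count≤1 (λ u → pos u ≟ k) (λ px py → pos-injective (trans px (sym py)))) (narrow k) ⟩
    suc c                                                        ∎
    where
    open ≤-Reasoning
    k = at j

  pathwidth : DPWAtMost G c
  pathwidth = decomposition , bag-size

module PathToCut (G : Digraph) (D : DPathDecomposition G) {p : ℕ}
  (thin : ∀ j → ∣ bag D j ∣ ≤ suc p) where

  interp≤ : ∀ {a t b v} → a F.≤ t → t F.≤ b → v ∈ bag D a → v ∈ bag D b → v ∈ bag D t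
  interp≤ {a} {t} {b} {v} a≤t t≤b v∈a v∈b with m≤n⇒m<n∨m≡n a≤t | m≤n⇒m<n∨m≡n t≤b
  ... | inj₂ a≡t | _        = subst (λ x → v ∈ bag D x) (FinP.toℕ-injective a≡t) v∈a
  ... | inj₁ _   | inj₂ t≡b = subst (λ x → v ∈ bag D x) (sym (FinP.toℕ-injective t≡b)) v∈b
  ... | inj₁ a<t | inj₁ t<b = interp D a t b a<t t<b v v∈a v∈b

  firstBag lastBag : Fin (n G) → Fin (r D)
  firstBag u = proj₁ (firstIndex (λ j → u ∈? bag D j) (cover D u))
  lastBag  u = proj₁ (lastIndex  (λ j → u ∈? bag D j) (cover D u))

  ∈firstBag : ∀ u → u ∈ bag D (firstBag u)
  ∈firstBag u = proj₁ (proj₂ (firstIndex (λ j → u ∈? bag D j) (cover D u)))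

  ∈lastBag : ∀ u → u ∈ bag D (lastBag u)
  ∈lastBag u = proj₁ (proj₂ (lastIndex (λ j → u ∈? bag D j) (cover D u)))

  firstBag-least : ∀ {u j} → u ∈ bag D j → firstBag u F.≤ j
  firstBag-least {u} {j} = proj₂ (proj₂ (firstIndex (λ j → u ∈? bag D j) (cover D u))) j

  lastBag-greatest : ∀ {u j} → u ∈ bag D j → j F.≤ lastBag u
  lastBag-greatest {u} {j} = proj₂ (proj₂ (lastIndex (λ j → u ∈? bag D j) (cover D u))) j

  NonIncreasing : (Fin (n G) → Fin (r D)) → Permutation′ (n G) → Set
  NonIncreasing κ φ = ∀ x y → toℕ (φ ⟨$⟩ʳ x) ≤ toℕ (φ ⟨$⟩ʳ y) → κ y F.≤ κ x

  module _ (φ : Permutation′ (n G)) where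
    open Cuts G φ

    CutCover : (Fin (n G) → Fin (n G) → Fin (n G)) → ℕ → Set
    CutCover end i = Σ (Subset (n G)) λ S → ∣ S ∣ ≤ suc p × (∀ {u v} → Crosses i u v → end u v ∈ S)

    -- If, for every vertex w, the chosen endpoint of each edge passing over
    -- w lies in the bag `B w`, then every cut has such a cover: the bag of
    -- the vertex just before the cut, or ∅ if the cut is not crossed.
    cutCover : (end : Fin (n G) → Fin (n G) → Fin (n G)) (B : Fin (n G) → Fin (r D)) →
      (∀ {u v w} → adj G u v ≡ true → pos u ≤ pos w → pos w < pos v → end u v ∈ bag D (B w)) →
      ∀ i → CutCover end i
    cutCover end B passing i with FinP.any? (λ w → pos w ≟ i ∸ 1)
    ... | yes (w , pw≡) = bag D (B w) , thin (B w) ,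
          λ cross → let (pu≤pw , pw<pv) = straddles cross pw≡ in passing (proj₁ cross) pu≤pw pw<pv
    ... | no vacant = ∅ , ≤-trans (≤-reflexive (∣⊥∣≡0 (n G))) z≤n ,
          λ cross → contradiction (occupant cross) vacant

  smallWeight : ∀ (S : Subset (n G)) (g : Fin (n G) → ℕ) {d} → (∀ x → g x ≤ d) → ∣ S ∣ ≤ suc p →
    sumF (λ x → ind (does (x ∈? S)) * g x) ≤ lin d d p
  smallWeight S g {d} g≤d small = begin
    sumF (λ x → ind (does (x ∈? S)) * g x) ≤⟨ weight≤ S g g≤d ⟩
    d * ∣ S ∣                              ≤⟨ *-monoʳ-≤ d small ⟩
    d * suc p                              ≡⟨ *-suc d p ⟩
    d + d * p                              ≡⟨ +-comm d (d * p) ⟩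
    lin d d p                              ∎
    where open ≤-Reasoning

  module _ (φ : Permutation′ (n G)) (lastBag-nonIncreasing : NonIncreasing lastBag φ) where
    open Cuts G φ

    tail-in-lastBag : ∀ {u v w} → adj G u v ≡ true → pos u ≤ pos w → pos w < pos v → u ∈ bag D (lastBag w)
    tail-in-lastBag {u} {v} {w} u→v pu≤pw pw<pv with edge D u v u→v
    ... | a , b , a≤b , u∈a , v∈b = interp≤ a≤lw (lastBag-nonIncreasing u w pu≤pw) u∈a (∈lastBag u)
      where
      a≤lw : a F.≤ lastBag w
      a≤lw = ≤-trans a≤b (≤-trans (lastBag-greatest v∈b) (lastBag-nonIncreasing w v (<⇒≤ pw<pv)))

    cut≤⁺ : ∀ {d} → Δ⁺ G ≤ d → ∀ i → cutSize G φ i ≤ lin d d p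
    cut≤⁺ {d} Δ⁺≤d i = bound (cutCover φ (λ u v → u) lastBag tail-in-lastBag i)
      where
      bound : CutCover φ (λ u v → u) i → cutSize G φ i ≤ lin d d p
      bound (S , small , tails) = ≤-trans (cut≤tails i S tails)
        (smallWeight S (outdeg G) (λ u → ≤-trans (term≤maxF (outdeg G) u) Δ⁺≤d) small)

  module _ (φ : Permutation′ (n G)) (firstBag-nonIncreasing : NonIncreasing firstBag φ) where
    open Cuts G φ

    head-in-firstBag : ∀ {u v w} → adj G u v ≡ true → pos u ≤ pos w → pos w < pos v → v ∈ bag D (firstBag w)
    head-in-firstBag {u} {v} {w} u→v pu≤pw pw<pv with edge D u v u→v
    ... | a , b , a≤b , u∈a , v∈b = interp≤ (firstBag-nonIncreasing w v (<⇒≤ pw<pv)) fw≤b (∈firstBag v) v∈b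
      where
      fw≤b : firstBag w F.≤ b
      fw≤b = ≤-trans (firstBag-nonIncreasing u w pu≤pw) (≤-trans (firstBag-least u∈a) a≤b)

    cut≤⁻ : ∀ {d} → Δ⁻ G ≤ d → ∀ i → cutSize G φ i ≤ lin d d p
    cut≤⁻ {d} Δ⁻≤d i = bound (cutCover φ (λ u v → v) firstBag head-in-firstBag i)
      where
      bound : CutCover φ (λ u v → v) i → cutSize G φ i ≤ lin d d p
      bound (S , small , heads) = ≤-trans (cut≤heads i S heads)
        (smallWeight S (indeg G) (λ v → ≤-trans (term≤maxF (indeg G) v) Δ⁻≤d) small)

  cutwidth⁺ : ∀ {d} → Δ⁺ G ≤ d → DCutwAtMost G (lin d d p)
  cutwidth⁺ {d} Δ⁺≤d = fromLayout (descendingLayout (λ u → toℕ (lastBag u)))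
    where
    fromLayout : Σ (Permutation′ (n G)) (NonIncreasing lastBag) → DCutwAtMost G (lin d d p)
    fromLayout (φ , nonIncreasing) = φ , cut≤⁺ φ nonIncreasing Δ⁺≤d

  cutwidth⁻ : ∀ {d} → Δ⁻ G ≤ d → DCutwAtMost G (lin d d p)
  cutwidth⁻ {d} Δ⁻≤d = fromLayout (descendingLayout (λ u → toℕ (firstBag u)))
    where
    fromLayout : Σ (Permutation′ (n G)) (NonIncreasing firstBag) → DCutwAtMost G (lin d d p)
    fromLayout (φ , nonIncreasing) = φ , cut≤⁻ φ nonIncreasing Δ⁻≤d

cutwidth≤ : ∀ {G p d} → Δ⁻ G ⊓ Δ⁺ G ≤ d → DPWAtMost G p → DCutwAtMost G (lin d d p)
cutwidth≤ {G} bounded (D , thin) with ⊓-sel (Δ⁻ G) (Δ⁺ G)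
... | inj₁ min≡Δ⁻ = PathToCut.cutwidth⁻ G D thin (subst (_≤ _) min≡Δ⁻ bounded)
... | inj₂ min≡Δ⁺ = PathToCut.cutwidth⁺ G D thin (subst (_≤ _) min≡Δ⁺ bounded)

pathwidth≤ : ∀ {G c} → DCutwAtMost G c → DPWAtMost G c
pathwidth≤ {G} (φ , narrow) = CutToPath.pathwidth G φ narrow

theorem5p12 : (𝒢 : Digraph → Set) (d : ℕ) →
    (∀ G → 𝒢 G → Δ⁻ G ⊓ Δ⁺ G ≤ d) →
    Σ ℕ λ a₁ → Σ ℕ λ b₁ → Σ ℕ λ a₂ → Σ ℕ λ b₂ →
      ∀ G → 𝒢 G → ∀ p c → IsDPW G p → IsDCutw G c →
        (c ≤ lin a₁ b₁ p) × (p ≤ lin a₂ b₂ c)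
theorem5p12 𝒢 d bounded = d , d , 1 , 0 , λ G G∈𝒢 p c (pw≤p , p-least) (cw≤c , c-least) →
    c-least (lin d d p) (cutwidth≤ (bounded G G∈𝒢) pw≤p)
  , subst (p ≤_) (sym (lin-1-0 c)) (p-least c (pathwidth≤ cw≤c))
  where
  lin-1-0 : ∀ x → lin 1 0 x ≡ x
  lin-1-0 x = trans (+-identityʳ (1 * x)) (*-identityˡ x)
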